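{- For every $\beta\in S_6$, every $i\in\{1,\dots,6\}$, every $\varepsilon\in\{+,-\}$, and every $t\geq 4$, $\operatorname{Sh}_4(I_t(\beta,i,\varepsilon))\setminus\{1234,4321\}=\Sigma(\beta,i,\varepsilon)$.
   Context: For $\beta\in S_6$, $i\in\{1,\ldots,6\}$, $\varepsilon\in\{+,-\}$ and $t\geq 1$, $I_t(\beta,i,\varepsilon)\in S_{5+t}$ is the permutation obtained from $\beta$ by inflating its $i$th entry into an increasing block of length $t$ if $\varepsilon=+$, and into a decreasing block of length $t$ if $\varepsilon=-$ (i.e. the $i$th entry is replaced by $t$ consecutive positions holding $t$ consecutive values, in increasing resp. decreasing order, and the remaining entries keep their relative position and relative value with respect to the block). For a permutation $\pi$, $\operatorname{Sh}_4(\pi)$ is the set of patterns in $S_4$ contained (classically) in $\pi$. The stable non-monotone shadow is $\Sigma(\beta,i,\varepsilon)=\bigcup_{t=1}^{4}\bigl(\operatorname{Sh}_4(I_t(\beta,i,\varepsilon))\setminus\{1234,4321\}\bigr)$. -}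

module Defs where

open import Data.Nat using (ℕ; zero; suc; _+_; _∸_; _<_; _≤_; _<?_)
open import Data.Fin using (Fin; toℕ; fromℕ<)
open import Data.Fin.Permutation using (Permutation′; _⟨$⟩ʳ_)
open import Data.Product using (Σ; _×_; ∃)
open import Data.Sum using (_⊎_)
open import Relation.Nullary using (¬_; yes; no)
open import Relation.Binary.PropositionalEquality using (_≡_)
open import Function.Bundles using (_⇔_)

-- Permutations of S_n are bijections Fin n → Fin n (stdlib Permutation′ n),
-- read in one-line notation: position k (0-indexed) holds value π(k) (0-indexed).

data Sign : Set where
  plus minus : Sign

entry : Permutation′ 6 → ℕ → ℕ
entry β p with p <? 6
... | yes p<6 = toℕ (β ⟨$⟩ʳ fromℕ< p<6)
... | no  _   = 0

-- Shift a value of β to make room for the block (value v is inflated to t values).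
lift : ℕ → ℕ → ℕ → ℕ
lift v t x with x <? v
... | yes _ = x
... | no  _ = x + (t ∸ 1)

-- The i-th entry (0-indexed) of β, with value v, is replaced by the block of
-- positions i,…,i+t-1 carrying values v,…,v+t-1 (increasing for plus,
-- decreasing for minus); other entries keep their relative order w.r.t. the block.
inflateℕ : Permutation′ 6 → Fin 6 → Sign → (t : ℕ) → ℕ → ℕ
inflateℕ β i ε t p with p <? toℕ i
... | yes _ = lift v t (entry β p)
  where v = entry β (toℕ i)
... | no _ with p <? toℕ i + t
...   | yes _ = blk ε
  where
    v = entry β (toℕ i)
    k = p ∸ toℕ i
    blk : Sign → ℕ
    blk plus  = v + k
    blk minus = v + ((t ∸ 1) ∸ k)
...   | no _ = lift v t (entry β (p ∸ (t ∸ 1)))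
  where v = entry β (toℕ i)

inflate : Permutation′ 6 → Fin 6 → Sign → (t : ℕ) → Fin (5 + t) → ℕ
inflate β i ε t p = inflateℕ β i ε t (toℕ p)

Contains : ∀ {n k} → (Fin n → ℕ) → Permutation′ k → Set
Contains {n} {k} π σ =
  Σ (Fin k → Fin n) λ f →
    (∀ a b → toℕ a < toℕ b → toℕ (f a) < toℕ (f b)) ×
    (∀ a b → (π (f a) < π (f b)) ⇔ (toℕ (σ ⟨$⟩ʳ a) < toℕ (σ ⟨$⟩ʳ b)))

Is1234 : Permutation′ 4 → Set
Is1234 σ = ∀ a → toℕ (σ ⟨$⟩ʳ a) ≡ toℕ a

Is4321 : Permutation′ 4 → Set
Is4321 σ = ∀ a → toℕ (σ ⟨$⟩ʳ a) ≡ 3 ∸ toℕ a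

NonMonoSh4 : ∀ {n} → (Fin n → ℕ) → Permutation′ 4 → Set
NonMonoSh4 π σ = Contains π σ × ¬ Is1234 σ × ¬ Is4321 σ

StableShadow : Permutation′ 6 → Fin 6 → Sign → Permutation′ 4 → Set
StableShadow β i ε σ =
  ∃ λ t → 1 ≤ t × t ≤ 4 × NonMonoSh4 (inflate β i ε t) σ

{-# OPTIONS --safe #-}
-- Growing the block of I_t to length t + 1 inserts one new position and one new value without
-- changing the relative order of the old entries, so every pattern of I_t occurs in I_(t+1).
-- Conversely, an occurrence of a pattern of length k ≤ t in I_(t+1) misses one of the first
-- k + 1 positions of the block (pigeonhole), and deleting that entry gives back I_t. Hence
-- Sh_4(I_t) = Sh_4(I_4) ⊇ Sh_4(I_s) for 1 ≤ s ≤ 4 ≤ t.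
module Submission where

open import Defs
open import Data.Nat using (ℕ; zero; suc; _+_; _∸_; _<_; _≤_; _≤′_; ≤′-refl; ≤′-step; z≤n; s≤s; s≤s⁻¹; z<s; _<?_)
open import Data.Nat.Properties
open import Data.Fin as Fin using (Fin; toℕ; fromℕ<; punchIn; punchOut)
open import Data.Fin.Properties using (toℕ-fromℕ<; toℕ-injective; toℕ<n; punchIn-punchOut; pigeonhole; any?)
open import Data.Fin.Permutation using (Permutation′; _⟨$⟩ʳ_; _⟨$⟩ˡ_; inverseˡ)
open import Data.Product using (∃; _×_; _,_; proj₁; proj₂)
open import Function using (_∘_)
open import Function.Bundles using (_⇔_; mk⇔; Equivalence)
open import Function.Definitions using (Injective)
open import Function.Properties.Equivalence using () renaming (sym to ⇔-sym; trans to ⇔-trans)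
open import Relation.Nullary using (yes; no; ¬?; contradiction)
open import Relation.Nullary.Decidable using (decidable-stable)
open import Relation.Binary.Definitions using (DecidableEquality; tri<; tri≈; tri>)
open import Relation.Binary.PropositionalEquality
open Equivalence using (to; from)

punchInℕ : ℕ → ℕ → ℕ
punchInℕ zero    p       = suc p
punchInℕ (suc c) zero    = zero
punchInℕ (suc c) (suc p) = suc (punchInℕ c p)

punchInℕ-< : ∀ {c p} → p < c → punchInℕ c p ≡ p
punchInℕ-< {suc c} {zero}  _   = refl
punchInℕ-< {suc c} {suc p} p<c = cong suc (punchInℕ-< (s≤s⁻¹ p<c))

punchInℕ-≥ : ∀ {c p} → c ≤ p → punchInℕ c p ≡ suc p
punchInℕ-≥ {zero}           _   = refl
punchInℕ-≥ {suc c} {suc p} c≤p = cong suc (punchInℕ-≥ (s≤s⁻¹ c≤p))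

punchInℕ≤suc : ∀ c p → punchInℕ c p ≤ suc p
punchInℕ≤suc zero    p       = ≤-refl
punchInℕ≤suc (suc c) zero    = z≤n
punchInℕ≤suc (suc c) (suc p) = s≤s (punchInℕ≤suc c p)

punchInℕ-+ : ∀ a c p → punchInℕ (a + c) (a + p) ≡ a + punchInℕ c p
punchInℕ-+ zero    c p = refl
punchInℕ-+ (suc a) c p = cong suc (punchInℕ-+ a c p)

punchInℕ-mono-< : ∀ c {p q} → p < q → punchInℕ c p < punchInℕ c q
punchInℕ-mono-< zero    p<q = s≤s p<q
punchInℕ-mono-< (suc c) {zero}  {suc q} _   = z<s
punchInℕ-mono-< (suc c) {suc p} {suc q} p<q = s≤s (punchInℕ-mono-< c (s≤s⁻¹ p<q))

punchInℕ-cancel-< : ∀ c {p q} → punchInℕ c p < punchInℕ c q → p < q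
punchInℕ-cancel-< zero    p<q = s≤s⁻¹ p<q
punchInℕ-cancel-< (suc c) {zero}  {suc q} _   = z<s
punchInℕ-cancel-< (suc c) {suc p} {suc q} p<q = s≤s (punchInℕ-cancel-< c (s≤s⁻¹ p<q))

punchInℕ-<⇔ : ∀ c {p q} → p < q ⇔ punchInℕ c p < punchInℕ c q
punchInℕ-<⇔ c = mk⇔ (punchInℕ-mono-< c) (punchInℕ-cancel-< c)

∸-punchInℕ : ∀ {u j k} → j ≤ suc u → k ≤ u →
  suc u ∸ punchInℕ j k ≡ punchInℕ (suc u ∸ j) (u ∸ k)
∸-punchInℕ {u} {j} {k} j≤1+u k≤u with k <? j
... | yes k<j = begin
  suc u ∸ punchInℕ j k    ≡⟨ cong (suc u ∸_) (punchInℕ-< k<j) ⟩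
  suc u ∸ k               ≡⟨ +-∸-assoc 1 k≤u ⟩
  suc (u ∸ k)             ≡⟨ punchInℕ-≥ (∸-monoʳ-≤ (suc u) k<j) ⟨
  punchInℕ (suc u ∸ j) (u ∸ k) ∎
  where open ≡-Reasoning
... | no k≮j = begin
  suc u ∸ punchInℕ j k    ≡⟨ cong (suc u ∸_) (punchInℕ-≥ j≤k) ⟩
  u ∸ k                   ≡⟨ punchInℕ-< u∸k<1+u∸j ⟨
  punchInℕ (suc u ∸ j) (u ∸ k) ∎
  where
  open ≡-Reasoning
  j≤k : j ≤ k
  j≤k = ≮⇒≥ k≮j
  u∸k<1+u∸j : u ∸ k < suc u ∸ j
  u∸k<1+u∸j = subst (u ∸ k <_) (sym (+-∸-assoc 1 (≤-trans j≤k k≤u))) (s≤s (∸-monoʳ-≤ u j≤k))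

toℕ-punchIn : ∀ {n} (c : Fin (suc n)) (p : Fin n) → toℕ (punchIn c p) ≡ punchInℕ (toℕ c) (toℕ p)
toℕ-punchIn Fin.zero    p          = refl
toℕ-punchIn (Fin.suc c) Fin.zero   = refl
toℕ-punchIn (Fin.suc c) (Fin.suc p) = cong suc (toℕ-punchIn c p)

punchIn-<⇔ : ∀ {n} (c : Fin (suc n)) {p q : Fin n} →
  toℕ p < toℕ q ⇔ toℕ (punchIn c p) < toℕ (punchIn c q)
punchIn-<⇔ c {p} {q} rewrite toℕ-punchIn c p | toℕ-punchIn c q = punchInℕ-<⇔ (toℕ c)

∃-avoided : ∀ {k} {A : Set} → DecidableEquality A → (f : Fin k → A) (g : Fin (suc k) → A) →
  Injective _≡_ _≡_ g → ∃ λ j → ∀ a → f a ≢ g j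
∃-avoided {k} _≟_ f g g-injective with any? (λ j → ¬? (any? (λ a → f a ≟ g j)))
... | yes (j , unhit) = j , λ a fa≡gj → unhit (a , fa≡gj)
... | no  allHit      = contradiction (cong toℕ (g-injective gj₁≡gj₂)) (<⇒≢ j₁<j₂)
  where
  hit : ∀ j → ∃ λ a → f a ≡ g j
  hit j = decidable-stable (any? (λ a → f a ≟ g j)) (λ unhit → allHit (j , unhit))
  collision = pigeonhole (n<1+n k) (proj₁ ∘ hit)
  j₁ = proj₁ collision
  j₂ = proj₁ (proj₂ collision)
  j₁<j₂ = proj₁ (proj₂ (proj₂ collision))
  gj₁≡gj₂ : g j₁ ≡ g j₂
  gj₁≡gj₂ = begin
    g j₁              ≡⟨ proj₂ (hit j₁) ⟨
    f (proj₁ (hit j₁)) ≡⟨ cong f (proj₂ (proj₂ (proj₂ collision))) ⟩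
    f (proj₁ (hit j₂)) ≡⟨ proj₂ (hit j₂) ⟩
    g j₂              ∎
    where open ≡-Reasoning

IsOccurrence : ∀ {n k} → (Fin n → ℕ) → Permutation′ k → (Fin k → Fin n) → Set
IsOccurrence π σ f =
  (∀ a b → toℕ a < toℕ b → toℕ (f a) < toℕ (f b)) ×
  (∀ a b → (π (f a) < π (f b)) ⇔ (toℕ (σ ⟨$⟩ʳ a) < toℕ (σ ⟨$⟩ʳ b)))

<-resp-≡⇔ : ∀ {x x′ y y′} → x ≡ x′ → y ≡ y′ → x < y ⇔ x′ < y′
<-resp-≡⇔ refl refl = mk⇔ (λ x<y → x<y) (λ x<y → x<y)

isOccurrence-transport : ∀ {n m k} {π : Fin n → ℕ} {π′ : Fin m → ℕ} {σ : Permutation′ k}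
  (g : Fin n → Fin m) (h : ℕ → ℕ) →
  (∀ {p q} → toℕ p < toℕ q ⇔ toℕ (g p) < toℕ (g q)) →
  (∀ {x y} → x < y ⇔ h x < h y) →
  (∀ p → π′ (g p) ≡ h (π p)) →
  {f : Fin k → Fin n} {f′ : Fin k → Fin m} → (∀ a → f′ a ≡ g (f a)) →
  IsOccurrence π σ f ⇔ IsOccurrence π′ σ f′
isOccurrence-transport {π = π} {π′} g h g-<⇔ h-<⇔ π′∘g≗h∘π {f} {f′} f′≗g∘f =
  mk⇔ (λ (mono , cmp) → (λ a b a<b → to (positions a b) (mono a b a<b)) ,
                        (λ a b → ⇔-trans (⇔-sym (values a b)) (cmp a b)))
      (λ (mono , cmp) → (λ a b a<b → from (positions a b) (mono a b a<b)) ,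
                        (λ a b → ⇔-trans (values a b) (cmp a b)))
  where
  positions : ∀ a b → toℕ (f a) < toℕ (f b) ⇔ toℕ (f′ a) < toℕ (f′ b)
  positions a b = ⇔-trans g-<⇔ (<-resp-≡⇔ (cong toℕ (sym (f′≗g∘f a))) (cong toℕ (sym (f′≗g∘f b))))
  value : ∀ a → h (π (f a)) ≡ π′ (f′ a)
  value a = sym (trans (cong π′ (f′≗g∘f a)) (π′∘g≗h∘π (f a)))
  values : ∀ a b → π (f a) < π (f b) ⇔ π′ (f′ a) < π′ (f′ b)
  values a b = ⇔-trans h-<⇔ (<-resp-≡⇔ (value a) (value b))

entry-< : ∀ β {p} (p<6 : p < 6) → entry β p ≡ toℕ (β ⟨$⟩ʳ fromℕ< p<6)
entry-< β {p} p<6 with p <? 6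
... | yes _   = refl
... | no  p≮6 = contradiction p<6 p≮6

entry-injective : ∀ β {p q} → p < 6 → q < 6 → entry β p ≡ entry β q → p ≡ q
entry-injective β {p} {q} p<6 q<6 eq = begin
  p                                       ≡⟨ toℕ-fromℕ< p<6 ⟨
  toℕ (fromℕ< p<6)                        ≡⟨ cong toℕ (inverseˡ β) ⟨
  toℕ (β ⟨$⟩ˡ (β ⟨$⟩ʳ fromℕ< p<6))        ≡⟨ cong (toℕ ∘ (β ⟨$⟩ˡ_)) (toℕ-injective images) ⟩
  toℕ (β ⟨$⟩ˡ (β ⟨$⟩ʳ fromℕ< q<6))        ≡⟨ cong toℕ (inverseˡ β) ⟩
  toℕ (fromℕ< q<6)                        ≡⟨ toℕ-fromℕ< q<6 ⟩
  q                                       ∎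
  where
  open ≡-Reasoning
  images : toℕ (β ⟨$⟩ʳ fromℕ< p<6) ≡ toℕ (β ⟨$⟩ʳ fromℕ< q<6)
  images = trans (sym (entry-< β p<6)) (trans eq (entry-< β q<6))

lift-< : ∀ {v t x} → x < v → lift v t x ≡ x
lift-< {v} {t} {x} x<v with x <? v
... | yes _   = refl
... | no  x≮v = contradiction x<v x≮v

lift-> : ∀ {v t x} → v < x → lift v t x ≡ x + (t ∸ 1)
lift-> {v} {t} {x} v<x with x <? v
... | yes x<v = contradiction x<v (<⇒≯ v<x)
... | no  _   = refl

lift-suc : ∀ {v w u x} → x ≢ v → v ≤ w → w ≤ v + suc u →
  lift v (suc (suc u)) x ≡ punchInℕ w (lift v (suc u) x)
lift-suc {v} {w} {u} {x} x≢v v≤w w≤v+1+u with <-cmp x v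
... | tri< x<v _ _ = begin
  lift v (suc (suc u)) x       ≡⟨ lift-< x<v ⟩
  x                            ≡⟨ punchInℕ-< (<-≤-trans x<v v≤w) ⟨
  punchInℕ w x                 ≡⟨ cong (punchInℕ w) (lift-< x<v) ⟨
  punchInℕ w (lift v (suc u) x) ∎
  where open ≡-Reasoning
... | tri≈ _ x≡v _ = contradiction x≡v x≢v
... | tri> _ _ v<x = begin
  lift v (suc (suc u)) x       ≡⟨ lift-> v<x ⟩
  x + suc u                    ≡⟨ +-suc x u ⟩
  suc (x + u)                  ≡⟨ punchInℕ-≥ w≤x+u ⟨
  punchInℕ w (x + u)           ≡⟨ cong (punchInℕ w) (lift-> v<x) ⟨
  punchInℕ w (lift v (suc u) x) ∎
  where
  open ≡-Reasoning
  w≤x+u : w ≤ x + u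
  w≤x+u = ≤-trans w≤v+1+u (≤-trans (≤-reflexive (+-suc v u)) (+-monoˡ-≤ u v<x))

blockOffset : Sign → ℕ → ℕ → ℕ
blockOffset plus  t k = k
blockOffset minus t k = (t ∸ 1) ∸ k

blockOffset≤ : ∀ ε {u j} → j ≤ suc u → blockOffset ε (suc (suc u)) j ≤ suc u
blockOffset≤ plus  j≤1+u = j≤1+u
blockOffset≤ minus {u} {j} _ = m∸n≤m (suc u) j

blockOffset-punchInℕ : ∀ ε {u j k} → j ≤ suc u → k ≤ u →
  blockOffset ε (suc (suc u)) (punchInℕ j k) ≡
  punchInℕ (blockOffset ε (suc (suc u)) j) (blockOffset ε (suc u) k)
blockOffset-punchInℕ plus  _     _   = refl
blockOffset-punchInℕ minus j≤1+u k≤u = ∸-punchInℕ j≤1+u k≤u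

-- In I_(1+u) with the block at I, the entry of β at position r > I sits at position r + u.
data Region (I u : ℕ) : ℕ → Set where
  before : ∀ {p} → p < I → Region I u p
  inside : ∀ {k} → k ≤ u → Region I u (I + k)
  after  : ∀ {r} → I < r → Region I u (r + u)

region : ∀ I u p → Region I u p
region I u p with p <? I
... | yes p<I = before p<I
... | no  p≮I with p <? I + suc u
...   | yes p<I+1+u = subst (Region I u) (m+[n∸m]≡n I≤p) (inside k≤u)
  where
  I≤p = ≮⇒≥ p≮I
  k≤u : p ∸ I ≤ u
  k≤u = s≤s⁻¹ (subst (p ∸ I <_) (m+n∸m≡n I (suc u)) (∸-monoˡ-< p<I+1+u I≤p))
...   | no  p≮I+1+u = subst (Region I u) (m∸n+n≡m u≤p) (after I<p∸u)
  where
  1+I+u≤p : suc I + u ≤ p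
  1+I+u≤p = subst (_≤ p) (+-suc I u) (≮⇒≥ p≮I+1+u)
  u≤p : u ≤ p
  u≤p = ≤-trans (m≤n+m u (suc I)) 1+I+u≤p
  I<p∸u : I < p ∸ u
  I<p∸u = subst (_≤ p ∸ u) (m+n∸n≡m (suc I) u) (∸-monoˡ-≤ u 1+I+u≤p)

module _ (β : Permutation′ 6) (i : Fin 6) where

  private
    I = toℕ i
    v = entry β I
    I<6 : I < 6
    I<6 = toℕ<n i

  inflateℕ-before : ∀ {ε t p} → p < I → inflateℕ β i ε t p ≡ lift v t (entry β p)
  inflateℕ-before {ε} {t} {p} p<I with p <? I
  ... | yes _   = refl
  ... | no  p≮I = contradiction p<I p≮I

  inflateℕ-inside : ∀ ε {t k} → k < t → inflateℕ β i ε t (I + k) ≡ v + blockOffset ε t k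
  inflateℕ-inside ε {t} {k} k<t with I + k <? I
  ... | yes I+k<I = contradiction I+k<I (m+n≮m I k)
  ... | no  _ with I + k <? I + t
  ...   | no  I+k≮I+t = contradiction (+-monoʳ-< I k<t) I+k≮I+t
  ...   | yes _ with ε
  ...     | plus  = cong (v +_) (m+n∸m≡n I k)
  ...     | minus = cong (λ k′ → v + ((t ∸ 1) ∸ k′)) (m+n∸m≡n I k)

  inflateℕ-after : ∀ {ε u r} → I < r → inflateℕ β i ε (suc u) (r + u) ≡ lift v (suc u) (entry β r)
  inflateℕ-after {ε} {u} {r} I<r with r + u <? I
  ... | yes r+u<I = contradiction (≤-trans (<⇒≤ I<r) (m≤m+n r u)) (<⇒≱ r+u<I)
  ... | no  _ with r + u <? I + suc u
  ...   | yes r+u<I+1+u = contradiction (subst (_≤ r + u) (sym (+-suc I u)) (+-monoˡ-≤ u I<r)) (<⇒≱ r+u<I+1+u)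
  ...   | no  _ rewrite m+n∸n≡m r u = refl

  newValue : Sign → ℕ → ℕ → ℕ
  newValue ε u j = v + blockOffset ε (suc (suc u)) j

  private
    lift-suc-entry : ∀ ε {u j p} → j ≤ suc u → p < 6 → p ≢ I →
      lift v (suc (suc u)) (entry β p) ≡ punchInℕ (newValue ε u j) (lift v (suc u) (entry β p))
    lift-suc-entry ε j≤1+u p<6 p≢I =
      lift-suc (p≢I ∘ entry-injective β p<6 I<6) (m≤m+n v _) (+-monoʳ-≤ v (blockOffset≤ ε j≤1+u))

  inflateℕ-punchInℕ-before : ∀ ε {u j p} → j ≤ suc u → p < I →
    inflateℕ β i ε (suc (suc u)) (punchInℕ (I + j) p) ≡
    punchInℕ (newValue ε u j) (inflateℕ β i ε (suc u) p)
  inflateℕ-punchInℕ-before ε {u} {j} {p} j≤1+u p<I = begin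
    inflateℕ β i ε (suc (suc u)) (punchInℕ (I + j) p)
      ≡⟨ cong (inflateℕ β i ε (suc (suc u))) (punchInℕ-< (<-≤-trans p<I (m≤m+n I j))) ⟩
    inflateℕ β i ε (suc (suc u)) p
      ≡⟨ inflateℕ-before p<I ⟩
    lift v (suc (suc u)) (entry β p)
      ≡⟨ lift-suc-entry ε j≤1+u (<-trans p<I I<6) (<⇒≢ p<I) ⟩
    punchInℕ (newValue ε u j) (lift v (suc u) (entry β p))
      ≡⟨ cong (punchInℕ (newValue ε u j)) (inflateℕ-before p<I) ⟨
    punchInℕ (newValue ε u j) (inflateℕ β i ε (suc u) p) ∎
    where open ≡-Reasoning

  inflateℕ-punchInℕ-inside : ∀ ε {u j k} → j ≤ suc u → k ≤ u →
    inflateℕ β i ε (suc (suc u)) (punchInℕ (I + j) (I + k)) ≡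
    punchInℕ (newValue ε u j) (inflateℕ β i ε (suc u) (I + k))
  inflateℕ-punchInℕ-inside ε {u} {j} {k} j≤1+u k≤u = begin
    inflateℕ β i ε (suc (suc u)) (punchInℕ (I + j) (I + k))
      ≡⟨ cong (inflateℕ β i ε (suc (suc u))) (punchInℕ-+ I j k) ⟩
    inflateℕ β i ε (suc (suc u)) (I + punchInℕ j k)
      ≡⟨ inflateℕ-inside ε (s≤s (≤-trans (punchInℕ≤suc j k) (s≤s k≤u))) ⟩
    v + blockOffset ε (suc (suc u)) (punchInℕ j k)
      ≡⟨ cong (v +_) (blockOffset-punchInℕ ε j≤1+u k≤u) ⟩
    v + punchInℕ (blockOffset ε (suc (suc u)) j) (blockOffset ε (suc u) k)
      ≡⟨ punchInℕ-+ v _ _ ⟨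
    punchInℕ (newValue ε u j) (v + blockOffset ε (suc u) k)
      ≡⟨ cong (punchInℕ (newValue ε u j)) (inflateℕ-inside ε (s≤s k≤u)) ⟨
    punchInℕ (newValue ε u j) (inflateℕ β i ε (suc u) (I + k)) ∎
    where open ≡-Reasoning

  inflateℕ-punchInℕ-after : ∀ ε {u j r} → j ≤ suc u → I < r → r < 6 →
    inflateℕ β i ε (suc (suc u)) (punchInℕ (I + j) (r + u)) ≡
    punchInℕ (newValue ε u j) (inflateℕ β i ε (suc u) (r + u))
  inflateℕ-punchInℕ-after ε {u} {j} {r} j≤1+u I<r r<6 = begin
    inflateℕ β i ε (suc (suc u)) (punchInℕ (I + j) (r + u))
      ≡⟨ cong (inflateℕ β i ε (suc (suc u))) (punchInℕ-≥ I+j≤r+u) ⟩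
    inflateℕ β i ε (suc (suc u)) (suc (r + u))
      ≡⟨ cong (inflateℕ β i ε (suc (suc u))) (+-suc r u) ⟨
    inflateℕ β i ε (suc (suc u)) (r + suc u)
      ≡⟨ inflateℕ-after I<r ⟩
    lift v (suc (suc u)) (entry β r)
      ≡⟨ lift-suc-entry ε j≤1+u r<6 (≢-sym (<⇒≢ I<r)) ⟩
    punchInℕ (newValue ε u j) (lift v (suc u) (entry β r))
      ≡⟨ cong (punchInℕ (newValue ε u j)) (inflateℕ-after I<r) ⟨
    punchInℕ (newValue ε u j) (inflateℕ β i ε (suc u) (r + u)) ∎
    where
    open ≡-Reasoning
    I+j≤r+u : I + j ≤ r + u
    I+j≤r+u = ≤-trans (+-monoʳ-≤ I j≤1+u) (≤-trans (≤-reflexive (+-suc I u)) (+-monoˡ-≤ u I<r))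

  inflateℕ-punchInℕ : ∀ ε {u j} p → j ≤ suc u → p < 6 + u →
    inflateℕ β i ε (suc (suc u)) (punchInℕ (I + j) p) ≡
    punchInℕ (newValue ε u j) (inflateℕ β i ε (suc u) p)
  inflateℕ-punchInℕ ε {u} p j≤1+u p<6+u with region I u p
  ... | before p<I = inflateℕ-punchInℕ-before ε j≤1+u p<I
  ... | inside k≤u = inflateℕ-punchInℕ-inside ε j≤1+u k≤u
  ... | after {r} I<r = inflateℕ-punchInℕ-after ε j≤1+u I<r (+-cancelʳ-< u r 6 p<6+u)

  blockSlot : ∀ {u j} → j ≤ suc u → Fin (7 + u)
  blockSlot j≤1+u = fromℕ< (+-mono-<-≤ I<6 j≤1+u)

  inflate-punchIn : ∀ ε {u j} (j≤1+u : j ≤ suc u) (p : Fin (6 + u)) →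
    inflate β i ε (suc (suc u)) (punchIn (blockSlot j≤1+u) p) ≡
    punchInℕ (newValue ε u j) (inflate β i ε (suc u) p)
  inflate-punchIn ε {u} j≤1+u p = begin
    inflateℕ β i ε (suc (suc u)) (toℕ (punchIn (blockSlot j≤1+u) p))
      ≡⟨ cong (inflateℕ β i ε (suc (suc u))) (toℕ-punchIn (blockSlot j≤1+u) p) ⟩
    inflateℕ β i ε (suc (suc u)) (punchInℕ (toℕ (blockSlot j≤1+u)) (toℕ p))
      ≡⟨ cong (λ c → inflateℕ β i ε (suc (suc u)) (punchInℕ c (toℕ p))) (toℕ-fromℕ< _) ⟩
    inflateℕ β i ε (suc (suc u)) (punchInℕ (I + _) (toℕ p))
      ≡⟨ inflateℕ-punchInℕ ε (toℕ p) j≤1+u (toℕ<n p) ⟩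
    punchInℕ (newValue ε u _) (inflate β i ε (suc u) p) ∎
    where open ≡-Reasoning

  isOccurrence-inflate-suc⇔ : ∀ ε {u j} (j≤1+u : j ≤ suc u) {k} (σ : Permutation′ k) {f f′} →
    (∀ a → f′ a ≡ punchIn (blockSlot j≤1+u) (f a)) →
    IsOccurrence (inflate β i ε (suc u)) σ f ⇔ IsOccurrence (inflate β i ε (suc (suc u))) σ f′
  isOccurrence-inflate-suc⇔ ε {u} {j} j≤1+u σ =
    isOccurrence-transport {π = inflate β i ε (suc u)} {π′ = inflate β i ε (suc (suc u))} {σ = σ}
      (punchIn (blockSlot j≤1+u)) (punchInℕ (newValue ε u j))
      (punchIn-<⇔ (blockSlot j≤1+u)) (punchInℕ-<⇔ (newValue ε u j)) (inflate-punchIn ε j≤1+u)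

  contains-inflate-suc : ∀ ε {t k} (σ : Permutation′ k) → 1 ≤ t →
    Contains (inflate β i ε t) σ → Contains (inflate β i ε (suc t)) σ
  contains-inflate-suc ε σ (s≤s z≤n) (f , occ) =
    punchIn (blockSlot z≤n) ∘ f , to (isOccurrence-inflate-suc⇔ ε z≤n σ (λ _ → refl)) occ

  contains-inflate-pred : ∀ ε {t k} (σ : Permutation′ k) → 1 ≤ t → k ≤ t →
    Contains (inflate β i ε (suc t)) σ → Contains (inflate β i ε t) σ
  contains-inflate-pred ε {suc u} {k} σ _ k≤1+u (f , occ) =
    punchOut ∘ slot≢f , from (isOccurrence-inflate-suc⇔ ε j≤1+u σ (sym ∘ punchIn-punchOut ∘ slot≢f)) occ
    where
    avoided = ∃-avoided _≟_ (toℕ ∘ f) (λ j → I + toℕ j) (toℕ-injective ∘ +-cancelˡ-≡ I _ _)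
    j = proj₁ avoided
    j≤1+u : toℕ j ≤ suc u
    j≤1+u = ≤-trans (s≤s⁻¹ (toℕ<n j)) k≤1+u
    slot≢f : ∀ a → blockSlot j≤1+u ≢ f a
    slot≢f a slot≡fa = proj₂ avoided a (trans (cong toℕ (sym slot≡fa)) (toℕ-fromℕ< _))

  contains-inflate-mono : ∀ ε {s t k} (σ : Permutation′ k) → 1 ≤ s → s ≤′ t →
    Contains (inflate β i ε s) σ → Contains (inflate β i ε t) σ
  contains-inflate-mono ε σ 1≤s ≤′-refl        = λ occ → occ
  contains-inflate-mono ε σ 1≤s (≤′-step s≤′t) =
    contains-inflate-suc ε σ (≤-trans 1≤s (≤′⇒≤ s≤′t)) ∘ contains-inflate-mono ε σ 1≤s s≤′t

  contains-inflate-antimono : ∀ ε {s t k} (σ : Permutation′ k) → 1 ≤ s → k ≤ s → s ≤′ t →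
    Contains (inflate β i ε t) σ → Contains (inflate β i ε s) σ
  contains-inflate-antimono ε σ 1≤s k≤s ≤′-refl        = λ occ → occ
  contains-inflate-antimono ε σ 1≤s k≤s (≤′-step s≤′t) =
    contains-inflate-antimono ε σ 1≤s k≤s s≤′t ∘
    contains-inflate-pred ε σ (≤-trans 1≤s (≤′⇒≤ s≤′t)) (≤-trans k≤s (≤′⇒≤ s≤′t))

lemma6p7 : (β : Permutation′ 6) (i : Fin 6) (ε : Sign) (t : ℕ) → 4 ≤ t →
    (σ : Permutation′ 4) → NonMonoSh4 (inflate β i ε t) σ ⇔ StableShadow β i ε σ
lemma6p7 β i ε t 4≤t σ = mk⇔
  (λ (occ , ¬1234 , ¬4321) →
     4 , s≤s z≤n , ≤-refl , contains-inflate-antimono β i ε σ (s≤s z≤n) ≤-refl (≤⇒≤′ 4≤t) occ , ¬1234 , ¬4321)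
  (λ (s , 1≤s , s≤4 , occ , ¬1234 , ¬4321) →
     contains-inflate-mono β i ε σ 1≤s (≤⇒≤′ (≤-trans s≤4 4≤t)) occ , ¬1234 , ¬4321)
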